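{- Let $r\geq 2$ with $r\equiv 2\pmod 4$. A cubical $r$-matrix $A$ is odd-colorable if and only if it has an odd transversal.
   Context: A cubical $r$-matrix of order $n$ is a function $A:[n]^r\to\mathbb{C}$, with entries $a_{i_1,\ldots,i_r}$. For even $r$, $A$ is odd-colorable if there is a map $\varphi:[n]\to[r]$ such that whenever $a_{i_1,\ldots,i_r}\neq 0$, we have $\varphi(i_1)+\cdots+\varphi(i_r)\equiv r/2 \pmod r$. A set $X\subset[n]$ is an odd transversal of $A$ if whenever $a_{i_1,\ldots,i_r}\neq0$, we have $I_X(i_1)+\cdots+I_X(i_r)\equiv 1\pmod 2$, where $I_X$ is the indicator function of $X$. -}

module Defs where

open import Data.Nat using (ℕ; zero; suc; _+_; _*_; _/_)
open import Data.Nat.Divisibility using (_∣_)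
open import Data.Fin using (Fin; toℕ)
open import Data.Bool using (Bool; true; false)
open import Data.Product using (Σ; ∃)
open import Relation.Binary.PropositionalEquality using (_≡_)
open import Relation.Nullary using (¬_)

_≡_[mod_] : ℕ → ℕ → ℕ → Set
a ≡ b [mod m ] = Σ ℕ (λ k → Σ ℕ (λ l → a + k * m ≡ b + l * m))

ΣFin : (r : ℕ) → (Fin r → ℕ) → ℕ
ΣFin zero    f = 0
ΣFin (suc r) f = f Fin.zero + ΣFin r (λ i → f (Fin.suc i))
  where import Data.Fin as Fin

CubicalMatrix : Set → ℕ → ℕ → Set
CubicalMatrix C r n = (Fin r → Fin n) → C

-- [r] = {1,…,r} is represented by Fin r with value toℕ c + 1.
colourValue : {r : ℕ} → Fin r → ℕ
colourValue c = suc (toℕ c)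

OddColorable : {C : Set} (zero : C) (r n : ℕ) → CubicalMatrix C r n → Set
OddColorable z r n A =
  Σ (Fin n → Fin r) λ φ →
    (i : Fin r → Fin n) → ¬ (A i ≡ z) →
      ΣFin r (λ j → colourValue (φ (i j))) ≡ r / 2 [mod r ]

indicator : {n : ℕ} → (Fin n → Bool) → Fin n → ℕ
indicator X i with X i
... | true  = 1
... | false = 0

OddTransversal : {C : Set} (zero : C) (r n : ℕ) → CubicalMatrix C r n → (Fin n → Bool) → Set
OddTransversal z r n A X =
  (i : Fin r → Fin n) → ¬ (A i ≡ z) →
    ΣFin r (λ j → indicator X (i j)) ≡ 1 [mod 2 ]

HasOddTransversal : {C : Set} (zero : C) (r n : ℕ) → CubicalMatrix C r n → Set
HasOddTransversal z r n A = Σ (Fin n → Bool) (OddTransversal z r n A)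

-- Write r = 2h with h odd. A colour sum ≡ h (mod r) is odd, so the indices of odd colour
-- form an odd transversal. Conversely, colour an odd transversal X by h and every other
-- index by r ≡ 0: a multi-index meeting X t times gets colour sum h·t, and h·t ≡ h (mod 2h)
-- for odd t.
module Submission where

open import Defs
open import Data.Nat using (ℕ; _≥_; suc; _+_; _*_; _%_; _/_; _≡ᵇ_; NonZero; s≤s)
open import Data.Nat.Properties using (+-suc; *-zeroʳ; *-distribˡ-+; +-commutativeSemigroup)
open import Algebra.Properties.CommutativeSemigroup +-commutativeSemigroup using (xy∙z≈xz∙y)
open import Data.Nat.DivMod
open import Data.Nat.Divisibility using (_∣_; divides)
open import Data.Nat.Tactic.RingSolver using (solve-∀)
open import Data.Fin using (Fin; toℕ; fromℕ<)
open import Data.Fin.Properties using (toℕ-fromℕ<)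
open import Data.Product using (_×_; _,_)
open import Data.Bool using (Bool)
open import Relation.Nullary using (¬_)
open import Function.Bundles using (_⇔_; mk⇔)
open import Relation.Binary.PropositionalEquality
open ≡-Reasoning

≡[mod]⇒%≡% : ∀ {a b} m .{{_ : NonZero m}} → a ≡ b [mod m ] → a % m ≡ b % m
≡[mod]⇒%≡% {a} {b} m (k , l , a+km≡b+lm) = begin
  a % m           ≡⟨ [m+kn]%n≡m%n a k m ⟨
  (a + k * m) % m ≡⟨ cong (_% m) a+km≡b+lm ⟩
  (b + l * m) % m ≡⟨ [m+kn]%n≡m%n b l m ⟩
  b % m           ∎

%≡%⇒≡[mod] : ∀ a b m .{{_ : NonZero m}} → a % m ≡ b % m → a ≡ b [mod m ]
%≡%⇒≡[mod] a b m a%m≡b%m = b / m , a / m , (begin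
  a + b / m * m                 ≡⟨ cong (_+ b / m * m) (m≡m%n+[m/n]*n a m) ⟩
  a % m + a / m * m + b / m * m ≡⟨ cong (λ x → x + a / m * m + b / m * m) a%m≡b%m ⟩
  b % m + a / m * m + b / m * m ≡⟨ xy∙z≈xz∙y (b % m) _ _ ⟩
  b % m + b / m * m + a / m * m ≡⟨ cong (_+ a / m * m) (m≡m%n+[m/n]*n b m) ⟨
  b + a / m * m                 ∎)

%-cong-+ : ∀ {a a′ b b′} d .{{_ : NonZero d}} →
  a % d ≡ a′ % d → b % d ≡ b′ % d → (a + b) % d ≡ (a′ + b′) % d
%-cong-+ {a} {a′} {b} {b′} d a≈a′ b≈b′ = begin
  (a + b) % d            ≡⟨ %-distribˡ-+ a b d ⟩
  (a % d + b % d) % d    ≡⟨ cong₂ (λ x y → (x + y) % d) a≈a′ b≈b′ ⟩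
  (a′ % d + b′ % d) % d  ≡⟨ %-distribˡ-+ a′ b′ d ⟨
  (a′ + b′) % d          ∎

%-weaken : ∀ {a b} d m .{{_ : NonZero d}} .{{_ : NonZero m}} →
  d ∣ m → a % m ≡ b % m → a % d ≡ b % d
%-weaken {a} {b} d m d∣m a%m≡b%m = begin
  a % d     ≡⟨ m∣n⇒o%n%m≡o%m d m a d∣m ⟨
  a % m % d ≡⟨ cong (_% d) a%m≡b%m ⟩
  b % m % d ≡⟨ m∣n⇒o%n%m≡o%m d m b d∣m ⟩
  b % d     ∎

ΣFin-cong-% : ∀ r d .{{_ : NonZero d}} (f g : Fin r → ℕ) →
  (∀ j → f j % d ≡ g j % d) → ΣFin r f % d ≡ ΣFin r g % d
ΣFin-cong-% 0       d f g f≈g = refl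
ΣFin-cong-% (suc r) d f g f≈g =
  %-cong-+ d (f≈g Fin.zero) (ΣFin-cong-% r d _ _ (λ j → f≈g (Fin.suc j)))
  where import Data.Fin as Fin

ΣFin-* : ∀ r c (f : Fin r → ℕ) → ΣFin r (λ j → c * f j) ≡ c * ΣFin r f
ΣFin-* 0       c f = sym (*-zeroʳ c)
ΣFin-* (suc r) c f = begin
  c * f Fin.zero + ΣFin r (λ j → c * f (Fin.suc j)) ≡⟨ cong (c * f Fin.zero +_) (ΣFin-* r c _) ⟩
  c * f Fin.zero + c * ΣFin r (λ j → f (Fin.suc j)) ≡⟨ *-distribˡ-+ c (f Fin.zero) _ ⟨
  c * ΣFin (suc r) f                                ∎
  where import Data.Fin as Fin

*-odd-%-double : ∀ h t r .{{_ : NonZero r}} → h * 2 ≡ r → t % 2 ≡ 1 → h * t % r ≡ h % r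
*-odd-%-double h t r h*2≡r t%2≡1 = begin
  h * t % r                   ≡⟨ cong (λ x → h * x % r) (m≡m%n+[m/n]*n t 2) ⟩
  h * (t % 2 + t / 2 * 2) % r ≡⟨ cong (λ x → h * (x + t / 2 * 2) % r) t%2≡1 ⟩
  h * (1 + t / 2 * 2) % r     ≡⟨ cong (_% r) (odd-distrib h (t / 2)) ⟩
  (h + t / 2 * (h * 2)) % r   ≡⟨ cong (λ x → (h + t / 2 * x) % r) h*2≡r ⟩
  (h + t / 2 * r) % r         ≡⟨ [m+kn]%n≡m%n h (t / 2) r ⟩
  h % r                       ∎
  where
  odd-distrib : ∀ h s → h * (1 + s * 2) ≡ h + s * (h * 2)
  odd-distrib = solve-∀

half-of-≡2[mod4] : ∀ r → r % 4 ≡ 2 → 2 ∣ r × r / 2 % 2 ≡ 1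
half-of-≡2[mod4] r r%4≡2 = divides h r≡h*2
                         , trans (cong (_% 2) r/2≡h) ([m+kn]%n≡m%n 1 (r / 4) 2)
  where
  h : ℕ
  h = 1 + r / 4 * 2
  r≡h*2 : r ≡ h * 2
  r≡h*2 = begin
    r                 ≡⟨ m≡m%n+[m/n]*n r 4 ⟩
    r % 4 + r / 4 * 4 ≡⟨ cong (_+ r / 4 * 4) r%4≡2 ⟩
    2 + r / 4 * 4     ≡⟨ double (r / 4) ⟩
    h * 2             ∎
    where
    double : ∀ q → 2 + q * 4 ≡ (1 + q * 2) * 2
    double = solve-∀
  r/2≡h : r / 2 ≡ h
  r/2≡h = trans (/-congˡ r≡h*2) (m*n/n≡m h 2)

indicator-odd : ∀ {n} (v : Fin n → ℕ) x → indicator (λ y → v y % 2 ≡ᵇ 1) x ≡ v x % 2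
indicator-odd v x with v x % 2 | m%n<n (v x) 2
... | 0 | _ = refl
... | 1 | _ = refl
... | suc (suc _) | s≤s (s≤s ())

-- colourValue takes the values 1, …, r, so every residue mod r is the value of a colour.
colourWithResidue : ∀ r .{{_ : NonZero r}} → ℕ → Fin r
colourWithResidue (suc r) v = fromℕ< (m%n<n (v + r) (suc r))

colourValue-colourWithResidue : ∀ r .{{_ : NonZero r}} v →
  colourValue (colourWithResidue r v) % r ≡ v % r
colourValue-colourWithResidue r@(suc r-1) v = begin
  suc (toℕ (fromℕ< (m%n<n (v + r-1) r))) % r ≡⟨ cong (λ x → suc x % r) (toℕ-fromℕ< _) ⟩
  (1 + (v + r-1) % r) % r                    ≡⟨ %-cong-+ {1} {1} {(v + r-1) % r} r refl (m%n%n≡m%n (v + r-1) r) ⟩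
  (1 + (v + r-1)) % r                        ≡⟨ cong (_% r) (+-suc v r-1) ⟨
  (v + r) % r                                ≡⟨ [m+n]%n≡m%n v r ⟩
  v % r                                      ∎

oddColorable⇒hasOddTransversal : ∀ {C} (0C : C) r n .{{_ : NonZero r}} →
  2 ∣ r → r / 2 % 2 ≡ 1 →
  (A : CubicalMatrix C r n) → OddColorable 0C r n A → HasOddTransversal 0C r n A
oddColorable⇒hasOddTransversal 0C r n 2∣r r/2-odd A (φ , colouring) = oddColours , transversal
  where
  colour : Fin n → ℕ
  colour x = colourValue (φ x)
  oddColours : Fin n → Bool
  oddColours x = colour x % 2 ≡ᵇ 1
  indicator≡parity : ∀ x → indicator oddColours x % 2 ≡ colour x % 2
  indicator≡parity x = trans (cong (_% 2) (indicator-odd colour x)) (m%n%n≡m%n (colour x) 2)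
  transversal : OddTransversal 0C r n A oddColours
  transversal i Ai≢0 = %≡%⇒≡[mod] _ 1 2 (begin
    ΣFin r (λ j → indicator oddColours (i j)) % 2 ≡⟨ ΣFin-cong-% r 2 _ _ (λ j → indicator≡parity (i j)) ⟩
    ΣFin r (λ j → colour (i j)) % 2              ≡⟨ %-weaken 2 r 2∣r (≡[mod]⇒%≡% r (colouring i Ai≢0)) ⟩
    r / 2 % 2                                    ≡⟨ r/2-odd ⟩
    1                                            ∎)

hasOddTransversal⇒oddColorable : ∀ {C} (0C : C) r n .{{_ : NonZero r}} → 2 ∣ r →
  (A : CubicalMatrix C r n) → HasOddTransversal 0C r n A → OddColorable 0C r n A
hasOddTransversal⇒oddColorable 0C r n 2∣r A (X , transversal) = φ , colouring
  where
  h : ℕ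
  h = r / 2
  φ : Fin n → Fin r
  φ x = colourWithResidue r (h * indicator X x)
  colouring : (i : Fin r → Fin n) → ¬ (A i ≡ 0C) → ΣFin r (λ j → colourValue (φ (i j))) ≡ h [mod r ]
  colouring i Ai≢0 = %≡%⇒≡[mod] _ h r (begin
    ΣFin r (λ j → colourValue (φ (i j))) % r ≡⟨ ΣFin-cong-% r r _ _ (λ j → colourValue-colourWithResidue r _) ⟩
    ΣFin r (λ j → h * indicator X (i j)) % r ≡⟨ cong (_% r) (ΣFin-* r h _) ⟩
    h * ΣFin r (λ j → indicator X (i j)) % r ≡⟨ *-odd-%-double h _ r (m/n*n≡m 2∣r) (≡[mod]⇒%≡% 2 (transversal i Ai≢0)) ⟩
    h % r                                    ∎)

proposition5 : (C : Set) (0C : C) (r n : ℕ) →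
    r ≥ 2 → r ≡ 2 [mod 4 ] →
    (A : CubicalMatrix C r n) →
    OddColorable 0C r n A ⇔ HasOddTransversal 0C r n A
proposition5 C 0C r@(suc _) n (s≤s _) r≡2[mod4] A =
  let 2∣r , r/2-odd = half-of-≡2[mod4] r (≡[mod]⇒%≡% 4 r≡2[mod4])
  in mk⇔ (oddColorable⇒hasOddTransversal 0C r n 2∣r r/2-odd A)
         (hasOddTransversal⇒oddColorable 0C r n 2∣r A)
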